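{- Let $v\ge 2$ and $s,t,k$ be integers with $1\le s<t\le k$, and suppose every prime divisor of $v$ is at least $k$. Then there exists an AOA$(s,t,k,v)$.
   Context: An orthogonal array OA$(t,k,v)$ is a $v^t\times k$ array with entries from a set $X$ of size $v$ such that the restriction to any $t$ columns contains every $t$-tuple of $X^t$ exactly once. An AOA$(s,t,k,v)$ is a $v^t\times (k+1)$ array $A$ such that: (1) the first $k$ columns form an OA$(t,k,v)$ on a set $X$ with $|X|=v$; (2) the last column has symbols from a set $Y$ with $|Y|=v^{t-s}$; (3) any $s$ of the first $k$ columns together with the last column contain every $(s+1)$-tuple of $X^s\times Y$ exactly once. -}

module Defs where

open import Data.Nat using (ℕ; _^_; _∸_)
open import Data.Fin using (Fin)
open import Data.Product using (Σ; _×_; _,_; proj₁)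
open import Relation.Binary.PropositionalEquality using (_≡_)
open import Function.Definitions using (Injective)

ExactlyOnce : {R T : Set} → (T → T → Set) → (R → T) → Set
ExactlyOnce {R} {T} _≈_ f =
  (y : T) → Σ R (λ r → (f r ≈ y) × ((r′ : R) → f r′ ≈ y → r′ ≡ r))

_≗ᵗ_ : {n : ℕ} {A : Set} → (Fin n → A) → (Fin n → A) → Set
f ≗ᵗ g = ∀ i → f i ≡ g i

Columns : ℕ → ℕ → Set
Columns m k = Σ (Fin m → Fin k) (Injective _≡_ _≡_)

IsOA : (t k v : ℕ) → (Fin (v ^ t) → Fin k → Fin v) → Set
IsOA t k v A =
  (c : Columns t k) →
  ExactlyOnce _≗ᵗ_ (λ (r : Fin (v ^ t)) (i : Fin t) → A r (proj₁ c i))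

_≈ₚ_ : {s : ℕ} {A B : Set} → (Fin s → A) × B → (Fin s → A) × B → Set
(x , y) ≈ₚ (x′ , y′) = (x ≗ᵗ x′) × (y ≡ y′)


record AOA (s t k v : ℕ) : Set where
  field
    A     : Fin (v ^ t) → Fin k → Fin v
    L     : Fin (v ^ t) → Fin (v ^ (t ∸ s))
    isOA  : IsOA t k v A
    isAug : (c : Columns s k) →
            ExactlyOnce _≈ₚ_
              (λ (r : Fin (v ^ t)) → (λ (i : Fin s) → A r (proj₁ c i)) , L r)

-- Rows are the polynomials of degree < t over ℤ/v (a row is the digit string of its
-- coefficients), column j is evaluation at the point j, and the last column records the
-- t − s coefficients of degree ≥ s. Two distinct points j, j′ < k differ by a number
-- below k, which is a unit mod v because every prime factor of v is at least k. With
-- unit differences, synthetic division shows that a polynomial with n coefficients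
-- vanishing mod v at n points is zero mod v. Hence any t columns determine the row, and
-- so do any s columns together with the coefficients of degree ≥ s. Both maps go from a
-- set of size v^t to a set of size v^t, so being injective they hit everything exactly once.
module Submission where

open import Data.Fin.Base
  using (Fin; zero; suc; toℕ; fromℕ<; cast; punchOut; combine; finToFun; funToFin;
         _↑ˡ_; _↑ʳ_; splitAt; join)
open import Data.Fin.Properties
  using (any?; _≟_; suc-injective; toℕ-injective; toℕ<n; toℕ-fromℕ<; punchOut-injective;
         injective⇒≤; cast-involutive; join-splitAt; finToFun-funToFin; funToFin-finToFin)
open import Data.Integer.Base using (ℤ; +_; 0ℤ; _+_; _-_; _*_; _^_; ∣_∣; _%ℕ_; _/ℕ_)
import Data.Integer.Properties as ℤ
open import Data.Integer.Coprimality using (Coprime; coprime-divisor)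
open import Data.Integer.DivMod using (n%ℕd<d; a≡a%ℕn+[a/ℕn]*n)
open import Data.Integer.Tactic.RingSolver using (solve-∀)
open import Data.Nat.Base as ℕ using (ℕ; NonZero; NonTrivial; _≤_; _<_; s≤s)
import Data.Nat.Properties as ℕ
import Data.Nat.Coprimality as ℕ
open import Data.Nat.Primality using (Prime; _Rough_; 0-rough; 1-rough; 2-rough; ∤⇒rough-suc; rough∧∣⇒prime)
open import Data.Product using (_×_; _,_; proj₁)
open import Data.Sum using ([_,_])
open import Data.Vec.Functional using (_++_)
open import Data.Vec.Functional.Properties using (lookup-++ˡ; lookup-++ʳ; ++-cong)
open import Function using (_∘_)
open import Function.Definitions using (Injective; StrictlySurjective)
open import Relation.Binary.PropositionalEquality
open import Relation.Nullary using (¬_; yes; no; contradiction)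

open import Defs

injective⇒strictlySurjective : ∀ {n} (f : Fin n → Fin n) → Injective _≡_ _≡_ f → StrictlySurjective _≡_ f
injective⇒strictlySurjective {ℕ.suc n} f f-injective y with any? (λ x → f x ≟ y)
... | yes hit  = hit
... | no  miss = contradiction (injective⇒≤ g-injective) ℕ.1+n≰n
  where
  y≢f : ∀ x → y ≢ f x
  y≢f x y≡fx = miss (x , sym y≡fx)

  g : Fin (ℕ.suc n) → Fin n
  g x = punchOut (y≢f x)

  g-injective : Injective _≡_ _≡_ g
  g-injective eq = f-injective (punchOut-injective (y≢f _) (y≢f _) eq)

injective⇒exactlyOnce : ∀ {n} {B : Set} {_≈_ : B → B → Set} (f : Fin n → B) (encode : B → Fin n) →
                        (∀ {b b′} → b ≈ b′ → encode b ≡ encode b′) →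
                        (∀ {b b′} → encode b ≡ encode b′ → b ≈ b′) →
                        (∀ {r r′} → f r ≈ f r′ → r ≡ r′) →
                        ExactlyOnce _≈_ f
injective⇒exactlyOnce f encode encode-cong encode-reflects f-injective y
  with r , fr≡y ← injective⇒strictlySurjective (encode ∘ f) (f-injective ∘ encode-reflects) (encode y)
  = r , encode-reflects fr≡y , λ r′ fr′≈y → f-injective (encode-reflects (trans (encode-cong fr′≈y) (sym fr≡y)))

funToFin-cong : ∀ {m n} {f g : Fin m → Fin n} → f ≗ g → funToFin f ≡ funToFin g
funToFin-cong {ℕ.zero}  f≗g = refl
funToFin-cong {ℕ.suc m} f≗g = cong₂ combine (f≗g zero) (funToFin-cong (f≗g ∘ suc))

funToFin-injective : ∀ {m n} {f g : Fin m → Fin n} → funToFin f ≡ funToFin g → f ≗ g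
funToFin-injective {f = f} {g} eq i = begin
  f i                       ≡⟨ finToFun-funToFin f i ⟨
  finToFun (funToFin f) i   ≡⟨ cong (λ r → finToFun r i) eq ⟩
  finToFun (funToFin g) i   ≡⟨ finToFun-funToFin g i ⟩
  g i                       ∎
  where open ≡-Reasoning

finToFun-injective : ∀ {m n} {r r′ : Fin (m ℕ.^ n)} → finToFun {m} {n} r ≗ finToFun r′ → r ≡ r′
finToFun-injective {m} {n} {r} {r′} eq =
  trans (sym (funToFin-finToFin {n} {m} r)) (trans (funToFin-cong eq) (funToFin-finToFin {n} {m} r′))

∀-↑ : ∀ {m n} {P : Fin (m ℕ.+ n) → Set} → (∀ i → P (i ↑ˡ n)) → (∀ j → P (m ↑ʳ j)) → ∀ i → P i
∀-↑ {m} {n} {P} low high i = subst P (join-splitAt m n i) ([_,_] {C = P ∘ join m n} low high (splitAt m i))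

∀-cast : ∀ {m n} {P : Fin n → Set} .(e : m ≡ n) → (∀ i → P (cast e i)) → ∀ j → P j
∀-cast {P = P} e h j = subst P (cast-involutive e (sym e) j) (h (cast (sym e) j))

++-injective : ∀ {A : Set} {m n} {xs xs′ : Fin m → A} {ys ys′ : Fin n → A} →
               xs ++ ys ≗ xs′ ++ ys′ → xs ≗ xs′ × ys ≗ ys′
++-injective {xs = xs} {xs′} {ys} {ys′} eq =
  (λ i → trans (sym (lookup-++ˡ xs ys i)) (trans (eq _) (lookup-++ˡ xs′ ys′ i))) ,
  (λ j → trans (sym (lookup-++ʳ xs ys j)) (trans (eq _) (lookup-++ʳ xs′ ys′ j)))

∣+m-+n∣<k : ∀ {m n k} → m < k → n < k → ∣ + m - + n ∣ < k
∣+m-+n∣<k {m} {n} m<k n<k =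
  subst (_< _) (cong ∣_∣ (sym (ℤ.m-n≡m⊖n m n))) (ℕ.≤-<-trans (ℤ.∣m⊝n∣≤m⊔n m n) (ℕ.⊔-lub m<k n<k))

∣+m-+n∣≡0⇒m≡n : ∀ {m n} → ∣ + m - + n ∣ ≡ 0 → m ≡ n
∣+m-+n∣≡0⇒m≡n {m} {n} eq = ℤ.+-injective (ℤ.i-j≡0⇒i≡j (+ m) (+ n) (ℤ.∣i∣≡0⇒i≡0 eq))

module _ where

  open import Data.Nat.Divisibility using (_∣_; 0∣⇒≡0; ∣⇒≤; hasNonTrivialDivisor)

  primeDivisors>⇒rough-suc : ∀ {m n} .{{_ : NonTrivial m}} → (∀ p → Prime p → p ∣ n → ℕ.suc m ≤ p) →
                             m Rough n → ℕ.suc m Rough n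
  primeDivisors>⇒rough-suc primes> m-rough =
    ∤⇒rough-suc (λ m∣n → ℕ.1+n≰n (primes> _ (rough∧∣⇒prime m-rough m∣n) m∣n)) m-rough

  primeDivisors≥⇒rough : ∀ {m n} → (∀ p → Prime p → p ∣ n → m ≤ p) → m Rough n
  primeDivisors≥⇒rough {0} _ = 0-rough
  primeDivisors≥⇒rough {1} _ = 1-rough
  primeDivisors≥⇒rough {2} _ = 2-rough
  primeDivisors≥⇒rough {ℕ.suc m@(ℕ.2+ _)} primes≥ =
    primeDivisors>⇒rough-suc primes≥
      (primeDivisors≥⇒rough {m} (λ p p-prime p∣n → ℕ.≤-trans (ℕ.n≤1+n m) (primes≥ p p-prime p∣n)))

  rough⇒coprime : ∀ {m n d} .{{_ : NonZero d}} → m Rough n → d < m → ℕ.Coprime n d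
  rough⇒coprime {d = ℕ.suc _} _ _ {0} (_ , 0∣d) = contradiction (0∣⇒≡0 0∣d) λ ()
  rough⇒coprime _ _ {1} _ = refl
  rough⇒coprime {d = ℕ.suc _} rough d<m {ℕ.suc (ℕ.suc _)} (i∣n , i∣d) =
    contradiction (hasNonTrivialDivisor (ℕ.≤-<-trans (∣⇒≤ i∣d) d<m) i∣n) rough

rough⇒distinct-coprime : ∀ {k v} → k Rough v → ∀ {i j : Fin k} → i ≢ j → Coprime (+ v) (+ toℕ i - + toℕ j)
rough⇒distinct-coprime {k} rough {i} {j} i≢j with ∣ + toℕ i - + toℕ j ∣ in eq
... | 0       = contradiction (toℕ-injective (∣+m-+n∣≡0⇒m≡n eq)) i≢j
... | ℕ.suc _ = rough⇒coprime rough (subst (_< k) eq (∣+m-+n∣<k (toℕ<n i) (toℕ<n j)))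

module _ where

  open import Data.Integer.Divisibility.Signed
    using (_∣_; divides; ∣⇒∣ᵤ; ∣ᵤ⇒∣; ∣m+n∣n⇒∣m; ∣n⇒∣m*n; ∣m∣n⇒∣m+n)
  open import Data.Nat.Divisibility using (>⇒∤) renaming (_∣_ to _∣ℕ_)

  ∣0 : ∀ {m} → m ∣ 0ℤ
  ∣0 = divides 0ℤ refl

  ≡⇒∣- : ∀ {m i j} → i ≡ j → m ∣ i - j
  ≡⇒∣- {i = i} refl = subst (_ ∣_) (sym (ℤ.+-inverseʳ i)) ∣0

  eval : ∀ {n} → (Fin n → ℤ) → ℤ → ℤ
  eval {ℕ.zero}  c y = 0ℤ
  eval {ℕ.suc n} c y = c zero + y * eval (c ∘ suc) y

  ∣-eval : ∀ {m n} (c : Fin n → ℤ) y → (∀ i → m ∣ c i) → m ∣ eval c y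
  ∣-eval {n = ℕ.zero}  c y _   = ∣0
  ∣-eval {n = ℕ.suc n} c y ∣c = ∣m∣n⇒∣m+n (∣c zero) (∣n⇒∣m*n y (∣-eval (c ∘ suc) y (∣c ∘ suc)))

  eval-sub : ∀ {n} (c d : Fin n → ℤ) y → eval (λ i → c i - d i) y ≡ eval c y - eval d y
  eval-sub {ℕ.zero}  c d y = refl
  eval-sub {ℕ.suc n} c d y = begin
    c zero - d zero + y * eval (λ i → c (suc i) - d (suc i)) y
      ≡⟨ cong (λ e → c zero - d zero + y * e) (eval-sub (c ∘ suc) (d ∘ suc) y) ⟩
    c zero - d zero + y * (eval (c ∘ suc) y - eval (d ∘ suc) y)
      ≡⟨ rearrange (c zero) (d zero) y (eval (c ∘ suc) y) (eval (d ∘ suc) y) ⟩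
    (c zero + y * eval (c ∘ suc) y) - (d zero + y * eval (d ∘ suc) y) ∎
    where
    open ≡-Reasoning
    rearrange : ∀ a b y p q → a - b + y * (p - q) ≡ (a + y * p) - (b + y * q)
    rearrange = solve-∀

  eval-cast : ∀ {m n} (e : m ≡ n) (c : Fin n → ℤ) y → eval (c ∘ cast e) y ≡ eval c y
  eval-cast {ℕ.zero}  {ℕ.zero}  e c y = refl
  eval-cast {ℕ.suc m} {ℕ.suc n} e c y = cong (λ p → c zero + y * p) (eval-cast (ℕ.suc-injective e) (c ∘ suc) y)

  eval-++ : ∀ s {u} (c : Fin (s ℕ.+ u) → ℤ) y →
            eval c y ≡ eval (c ∘ (_↑ˡ u)) y + y ^ s * eval (c ∘ (s ↑ʳ_)) y
  eval-++ ℕ.zero    c y = sym (trans (ℤ.+-identityˡ _) (ℤ.*-identityˡ _))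
  eval-++ (ℕ.suc s) {u} c y = begin
    c zero + y * eval (c ∘ suc) y
      ≡⟨ cong (λ p → c zero + y * p) (eval-++ s (c ∘ suc) y) ⟩
    c zero + y * (eval (c ∘ suc ∘ (_↑ˡ u)) y + y ^ s * eval (c ∘ suc ∘ (s ↑ʳ_)) y)
      ≡⟨ rearrange (c zero) y (eval (c ∘ suc ∘ (_↑ˡ u)) y) (y ^ s) (eval (c ∘ suc ∘ (s ↑ʳ_)) y) ⟩
    (c zero + y * eval (c ∘ suc ∘ (_↑ˡ u)) y) + y * y ^ s * eval (c ∘ suc ∘ (s ↑ʳ_)) y ∎
    where
    open ≡-Reasoning
    rearrange : ∀ a y l p h → a + y * (l + p * h) ≡ (a + y * l) + y * p * h
    rearrange = solve-∀

  -- Synthetic division by (y - a): the coefficients of the quotient.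
  divide : ∀ {n} → (Fin (ℕ.suc n) → ℤ) → ℤ → Fin n → ℤ
  divide {ℕ.suc n} c a zero    = eval (c ∘ suc) a
  divide {ℕ.suc n} c a (suc i) = divide (c ∘ suc) a i

  eval-divide : ∀ {n} (c : Fin (ℕ.suc n) → ℤ) a y → eval c y ≡ (y - a) * eval (divide c a) y + eval c a
  eval-divide {ℕ.zero}  c a y = rearrange (c zero) a y
    where
    rearrange : ∀ c a y → c + y * 0ℤ ≡ (y - a) * 0ℤ + (c + a * 0ℤ)
    rearrange = solve-∀
  eval-divide {ℕ.suc n} c a y = begin
    c zero + y * eval (c ∘ suc) y            ≡⟨ cong (λ p → c zero + y * p) (eval-divide (c ∘ suc) a y) ⟩
    c zero + y * ((y - a) * q + eval (c ∘ suc) a)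
      ≡⟨ rearrange (c zero) a y q (eval (c ∘ suc) a) ⟩
    (y - a) * (eval (c ∘ suc) a + y * q) + (c zero + a * eval (c ∘ suc) a) ∎
    where
    open ≡-Reasoning
    q = eval (divide (c ∘ suc) a) y
    rearrange : ∀ c a y q e → c + y * ((y - a) * q + e) ≡ (y - a) * (e + y * q) + (c + a * e)
    rearrange = solve-∀

  ∣-head : ∀ {m n} (c : Fin (ℕ.suc n) → ℤ) a → m ∣ eval c a → m ∣ eval (c ∘ suc) a → m ∣ c zero
  ∣-head c a ∣c[a] ∣tail = ∣m+n∣n⇒∣m ∣c[a] (∣n⇒∣m*n a ∣tail)

  ∣-divide⇒∣ : ∀ {m n} (c : Fin (ℕ.suc n) → ℤ) a → m ∣ eval c a → (∀ i → m ∣ divide c a i) →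
               ∀ i → m ∣ c i
  ∣-divide⇒∣ {n = ℕ.zero}  c a ∣c[a] _  zero    = ∣-head c a ∣c[a] ∣0
  ∣-divide⇒∣ {n = ℕ.suc n} c a ∣c[a] ∣q zero    = ∣-head c a ∣c[a] (∣q zero)
  ∣-divide⇒∣ {n = ℕ.suc n} c a ∣c[a] ∣q (suc i) = ∣-divide⇒∣ (c ∘ suc) a (∣q zero) (∣q ∘ suc) i

  ∣-eval⇒∣-coefficients : ∀ {m n} (c x : Fin n → ℤ) → (∀ {i j} → i ≢ j → Coprime m (x i - x j)) →
                          (∀ i → m ∣ eval c (x i)) → ∀ i → m ∣ c i
  ∣-eval⇒∣-coefficients {n = ℕ.zero}      c x x-coprime ∣c[x] ()
  ∣-eval⇒∣-coefficients {m} {n = ℕ.suc n} c x x-coprime ∣c[x] =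
    ∣-divide⇒∣ c (x zero) (∣c[x] zero)
      (∣-eval⇒∣-coefficients (divide c (x zero)) (x ∘ suc) (λ i≢j → x-coprime (i≢j ∘ suc-injective)) ∣q[x])
    where
    ∣q[x] : ∀ j → m ∣ eval (divide c (x zero)) (x (suc j))
    ∣q[x] j = ∣ᵤ⇒∣ (coprime-divisor m (x (suc j) - x zero) _ (x-coprime λ ()) (∣⇒∣ᵤ ∣[x-x₀]q))
      where
      ∣[x-x₀]q : m ∣ (x (suc j) - x zero) * eval (divide c (x zero)) (x (suc j))
      ∣[x-x₀]q = ∣m+n∣n⇒∣m (subst (m ∣_) (eval-divide c (x zero) (x (suc j))) (∣c[x] (suc j))) (∣c[x] zero)

  ∣-eval∧∣-high⇒∣-coefficients : ∀ {m} s {u} (c : Fin (s ℕ.+ u) → ℤ) (x : Fin s → ℤ) →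
                                 (∀ {i j} → i ≢ j → Coprime m (x i - x j)) →
                                 (∀ j → m ∣ c (s ↑ʳ j)) → (∀ i → m ∣ eval c (x i)) → ∀ i → m ∣ c i
  ∣-eval∧∣-high⇒∣-coefficients {m} s {u} c x x-coprime ∣high ∣c[x] = ∀-↑ ∣low ∣high
    where
    ∣low[x] : ∀ i → m ∣ eval (c ∘ (_↑ˡ u)) (x i)
    ∣low[x] i = ∣m+n∣n⇒∣m (subst (m ∣_) (eval-++ s c (x i)) (∣c[x] i))
                          (∣n⇒∣m*n (x i ^ s) (∣-eval (c ∘ (s ↑ʳ_)) (x i) ∣high))

    ∣low : ∀ i → m ∣ c (i ↑ˡ u)
    ∣low = ∣-eval⇒∣-coefficients (c ∘ (_↑ˡ u)) x x-coprime ∣low[x]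

  module _ {v : ℕ} .{{_ : NonZero v}} where

    residue : ℤ → Fin v
    residue i = fromℕ< (n%ℕd<d i v)

    residue-≡⇒∣ : ∀ i j → residue i ≡ residue j → + v ∣ i - j
    residue-≡⇒∣ i j eq = divides (i /ℕ v - j /ℕ v) (begin
      i - j
        ≡⟨ cong₂ _-_ (a≡a%ℕn+[a/ℕn]*n i v) (a≡a%ℕn+[a/ℕn]*n j v) ⟩
      (+ (i %ℕ v) + i /ℕ v * + v) - (+ (j %ℕ v) + j /ℕ v * + v)
        ≡⟨ cong (λ r → (+ r + i /ℕ v * + v) - (+ (j %ℕ v) + j /ℕ v * + v)) same-remainder ⟩
      (+ (j %ℕ v) + i /ℕ v * + v) - (+ (j %ℕ v) + j /ℕ v * + v)
        ≡⟨ rearrange (+ (j %ℕ v)) (i /ℕ v) (j /ℕ v) (+ v) ⟩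
      (i /ℕ v - j /ℕ v) * + v ∎)
      where
      open ≡-Reasoning
      same-remainder : i %ℕ v ≡ j %ℕ v
      same-remainder = trans (sym (toℕ-fromℕ< _)) (trans (cong toℕ eq) (toℕ-fromℕ< _))
      rearrange : ∀ r p q v → (r + p * v) - (r + q * v) ≡ (p - q) * v
      rearrange = solve-∀

    ∣⇒≡ : ∀ {a b : Fin v} → + v ∣ + toℕ a - + toℕ b → a ≡ b
    ∣⇒≡ {a} {b} v∣a-b with ∣ + toℕ a - + toℕ b ∣ in eq
    ... | 0       = toℕ-injective (∣+m-+n∣≡0⇒m≡n eq)
    ... | ℕ.suc _ = contradiction (subst (v ∣ℕ_) eq (∣⇒∣ᵤ v∣a-b))
                    (>⇒∤ (subst (_< v) eq (∣+m-+n∣<k (toℕ<n a) (toℕ<n b))))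

  module PolynomialArray {v k : ℕ} .{{_ : NonZero v}} (x : Fin k → ℤ)
                         (x-coprime : ∀ {i j} → i ≢ j → Coprime (+ v) (x i - x j))
                         (s u t : ℕ) (s+u≡t : s ℕ.+ u ≡ t) where

    coefficients : Fin (v ℕ.^ t) → Fin t → ℤ
    coefficients r i = + toℕ (finToFun r i)

    array : Fin (v ℕ.^ t) → Fin k → Fin v
    array r j = residue (eval (coefficients r) (x j))

    high : Fin u → Fin t
    high j = cast s+u≡t (s ↑ʳ j)

    lastColumn : Fin (v ℕ.^ t) → Fin (v ℕ.^ u)
    lastColumn r = funToFin (finToFun r ∘ high)

    difference : Fin (v ℕ.^ t) → Fin (v ℕ.^ t) → Fin t → ℤ
    difference a b i = coefficients a i - coefficients b i

    ∣-difference⇒≡ : ∀ {a b} → (∀ i → + v ∣ difference a b i) → a ≡ b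
    ∣-difference⇒≡ ∣d = finToFun-injective {v} {t} (λ i → ∣⇒≡ (∣d i))

    ∣-eval-difference : ∀ {a b} j → array a j ≡ array b j → + v ∣ eval (difference a b) (x j)
    ∣-eval-difference {a} {b} j eq = subst (+ v ∣_) (sym (eval-sub (coefficients a) (coefficients b) (x j)))
                                           (residue-≡⇒∣ (eval (coefficients a) (x j)) (eval (coefficients b) (x j)) eq)

    isOA : IsOA t k v array
    isOA (col , col-injective) =
      injective⇒exactlyOnce _ funToFin (funToFin-cong {t} {v}) (funToFin-injective {t} {v}) rows-equal
      where
      rows-equal : ∀ {a b} → (λ i → array a (col i)) ≗ (λ i → array b (col i)) → a ≡ b
      rows-equal {a} {b} eq = ∣-difference⇒≡
        (∣-eval⇒∣-coefficients (difference a b) (x ∘ col) (λ i≢j → x-coprime (i≢j ∘ col-injective))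
          (λ i → ∣-eval-difference (col i) (eq i)))

    encode : (Fin s → Fin v) × Fin (v ℕ.^ u) → Fin (v ℕ.^ t)
    encode (y , z) = funToFin ((y ++ finToFun z) ∘ cast (sym s+u≡t))

    encode-cong : ∀ {b b′} → b ≈ₚ b′ → encode b ≡ encode b′
    encode-cong {y , z} {y′ , .z} (y≗y′ , refl) = funToFin-cong {t} {v} (λ i → ++-cong y y′ y≗y′ (λ _ → refl) _)

    encode-reflects : ∀ {b b′} → encode b ≡ encode b′ → b ≈ₚ b′
    encode-reflects eq with y≗y′ , z≗z′ ← ++-injective (∀-cast (sym s+u≡t) (funToFin-injective {t} {v} eq))
      = y≗y′ , finToFun-injective {v} {u} z≗z′

    isAug : (c : Columns s k) → ExactlyOnce _≈ₚ_ (λ r → (λ i → array r (proj₁ c i)) , lastColumn r)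
    isAug (col , col-injective) = injective⇒exactlyOnce _ encode encode-cong encode-reflects rows-equal
      where
      rows-equal : ∀ {a b} → ((λ i → array a (col i)) , lastColumn a) ≈ₚ
                             ((λ i → array b (col i)) , lastColumn b) → a ≡ b
      rows-equal {a} {b} (eq , last-eq) = ∣-difference⇒≡ (∀-cast s+u≡t
        (∣-eval∧∣-high⇒∣-coefficients s (difference a b ∘ cast s+u≡t) (x ∘ col)
          (λ i≢j → x-coprime (i≢j ∘ col-injective))
          (λ j → ≡⇒∣- (cong (+_ ∘ toℕ) (funToFin-injective {u} {v} last-eq j)))
          (λ i → subst (+ v ∣_) (sym (eval-cast s+u≡t (difference a b) (x (col i))))
                   (∣-eval-difference (col i) (eq i)))))

open import Data.Nat.Divisibility using (_∣_)

theorem2p2 : (v s t k : ℕ) → 2 ≤ v → 1 ≤ s → s < t → t ≤ k →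
    ((p : ℕ) → Prime p → p ∣ v → k ≤ p) →
    AOA s t k v
theorem2p2 v s t k (s≤s _) _ s<t _ primes≥k = record
  { A = array ; L = lastColumn ; isOA = isOA ; isAug = isAug }
  where
  open PolynomialArray (λ j → + toℕ j) (rough⇒distinct-coprime (primeDivisors≥⇒rough primes≥k))
                       s (t ℕ.∸ s) t (ℕ.m+[n∸m]≡n (ℕ.<⇒≤ s<t))
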